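{- For every partition $\lambda$ and positive integer $n$, $T_{\max}$ is a highest weight element of $\mathrm{SVRPP}^n(\lambda)$ with $\mathrm{ircont}(T_{\max})=\bar\lambda^{(n)}$.
   Context: Boxes are $(i,j)$ (row $i$, column $j$). $\mathrm{SVRPP}^n(\lambda)$: fillings $T$ of the Young diagram of $\lambda$ by nonempty subsets $T(i,j)\subseteq[n]$ weakly increasing along rows and down columns ($A\le B$ meaning $\max A\le\min B$); $\mathrm{ircont}(T)=(r_1,\ldots,r_n)$, $r_k$ = number of columns containing a box whose set contains $k$. Highest weight: for $m\in[n-1]$, restrict $T$ to the boxes whose set meets $\{m,m+1\}$; a nonempty column of this restriction is $m$-pure if each of its boxes meets $\{m,m+1\}$ in exactly $\{m\}$, $(m+1)$-pure if exactly $\{m+1\}$, mixed otherwise; the $m$-signature lists, columns left to right, $+$ for $m$-pure and $-$ for $(m+1)$-pure columns; repeatedly cancel a $-$ immediately followed by a $+$. $T$ is a highest weight element if for every $m\in[n-1]$ no $-$ survives. Define $\lambda^\flat$ by $\lambda^\flat_1=\lambda_1$ and $\lambda^\flat_i=\max\{0,\min\{\lambda^\flat_{i-1}-1,\lambda_i\}\}$ for $i\ge2$; let $k$ be the number of positive parts of $\lambda^\flat$. Define $\bar\lambda^{(n)}=(\bar\lambda^{(n)}_1,\ldots,\bar\lambda^{(n)}_n)$ by: if $n\le k$, $\bar\lambda^{(n)}_i=\lambda^\flat_i+i-1$ for $i\le n$; if $n>k$, $\bar\lambda^{(n)}_i=\lambda^\flat_i+i-1$ for $i\le k$ and $\bar\lambda^{(n)}_i=k$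 for $k<i\le n$. Define $T_{\max}$ on boxes $(i,j)\in\lambda$ by $T_{\max}(i,j)=\{i\}$ if $i\le n$ and $j<\lambda^\flat_i$; $T_{\max}(i,j)=\{i,i+1,\ldots,n\}$ if $i\le n$ and $j=\lambda^\flat_i$; $T_{\max}(i,j)=\{n\}$ otherwise. -}

module Defs where

open import Data.Nat using (ℕ; zero; suc; _+_; _∸_; _⊓_; _≤_; _<_; _≤ᵇ_; _<ᵇ_; _≡ᵇ_)
open import Data.Bool using (Bool; true; false; _∧_; _∨_; not; if_then_else_)
open import Data.List using (List; []; _∷_; _++_; map; length; filterᵇ; upTo; foldr)
open import Data.Bool.ListAction using (all; any)
open import Data.List.Relation.Unary.All using (All)
open import Data.List.Relation.Unary.Linked using (Linked)
open import Data.List.Membership.Propositional using (_∈_)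
open import Data.Product using (_×_; ∃)
open import Relation.Binary.PropositionalEquality using (_≡_)
open import Relation.Nullary using (¬_)

-- Partitions: finite lists of positive integers, weakly decreasing.
-- la_i (1-indexed) is  part la i ; parts beyond the length are 0.

IsPartition : List ℕ → Set
IsPartition la = Linked (λ a b → b ≤ a) la × All (λ a → 0 < a) la

-- i-th entry (1-indexed), 0 if out of range (or i = 0)
part : List ℕ → ℕ → ℕ
part []       _             = 0
part (x ∷ xs) zero          = 0
part (x ∷ xs) (suc zero)    = x
part (x ∷ xs) (suc (suc i)) = part xs (suc i)

oneTo : ℕ → List ℕ
oneTo n = map suc (upTo n)

inBox : List ℕ → ℕ → ℕ → Bool
inBox la i j = (1 ≤ᵇ i) ∧ (i ≤ᵇ length la) ∧ (1 ≤ᵇ j) ∧ (j ≤ᵇ part la i)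

-- Fillings by subsets: T i j k = true  iff  k ∈ T(i,j).
-- (Only the values on boxes of la matter.)

Filling : Set
Filling = ℕ → ℕ → ℕ → Bool

SVRPP : ℕ → List ℕ → Filling → Set
SVRPP n la T =
  (∀ i j → inBox la i j ≡ true →
     (∀ k → T i j k ≡ true → 1 ≤ k × k ≤ n) × ∃ (λ k → T i j k ≡ true))
  × (∀ i j → inBox la i j ≡ true → inBox la i (suc j) ≡ true →
       ∀ a b → T i j a ≡ true → T i (suc j) b ≡ true → a ≤ b)
  × (∀ i j → inBox la i j ≡ true → inBox la (suc i) j ≡ true →
       ∀ a b → T i j a ≡ true → T (suc i) j b ≡ true → a ≤ b)

count : List Bool → ℕ
count []           = 0
count (true  ∷ bs) = suc (count bs)
count (false ∷ bs) = count bs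

ircontAt : List ℕ → Filling → ℕ → ℕ
ircontAt la T k =
  count (map (λ j → any (λ i → inBox la i j ∧ T i j k) (oneTo (length la)))
             (oneTo (part la 1)))

ircont : ℕ → List ℕ → Filling → List ℕ
ircont n la T = map (ircontAt la T) (oneTo n)

data Sign : Set where
  plus minus : Sign

colSign : List ℕ → Filling → ℕ → ℕ → List Sign
colSign la T m j =
  let rows  = filterᵇ (λ i → inBox la i j ∧ (T i j m ∨ T i j (suc m)))
                     (oneTo (length la))
  in go rows
  where
    go : List ℕ → List Sign
    go [] = []
    go rows@(_ ∷ _) =
      if all (λ i → T i j m ∧ not (T i j (suc m))) rows then plus ∷ []
      else if all (λ i → not (T i j m) ∧ T i j (suc m)) rows then minus ∷ []
      else []

signature : List ℕ → Filling → ℕ → List Sign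
signature la T m = foldr (λ j s → colSign la T m j ++ s) [] (oneTo (part la 1))

data Step : Set where
  done : Step
  changed : List Sign → Step

cancelOnce : List Sign → Step
cancelOnce [] = done
cancelOnce (minus ∷ plus ∷ s) = changed s
cancelOnce (x ∷ s) with cancelOnce s
... | done = done
... | changed s' = changed (x ∷ s')

-- repeat cancellation (at most `fuel` times; length of the word suffices)
cancelIter : ℕ → List Sign → List Sign
cancelIter zero s = s
cancelIter (suc f) s with cancelOnce s
... | done = s
... | changed s' = cancelIter f s'

reduced : List Sign → List Sign
reduced s = cancelIter (length s) s

HighestWeight : ℕ → List ℕ → Filling → Set
HighestWeight n la T =
  SVRPP n la T ×
  (∀ m → 1 ≤ m → m ≤ n ∸ 1 → ¬ (minus ∈ reduced (signature la T m)))

flatGo : ℕ → List ℕ → List ℕ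
flatGo prev [] = []
flatGo prev (x ∷ xs) = ((prev ∸ 1) ⊓ x) ∷ flatGo ((prev ∸ 1) ⊓ x) xs

flat : List ℕ → List ℕ
flat [] = []
flat (x ∷ xs) = x ∷ flatGo x xs

kOf : List ℕ → ℕ
kOf la = length (filterᵇ (λ a → 1 ≤ᵇ a) (flat la))

lambdaBar : ℕ → List ℕ → List ℕ
lambdaBar n la =
  map (λ i → if i ≤ᵇ kOf la then part (flat la) i + (i ∸ 1) else kOf la) (oneTo n)

Tmax : ℕ → List ℕ → Filling
Tmax n la i j k =
  if (i ≤ᵇ n) ∧ (j <ᵇ part (flat la) i) then (k ≡ᵇ i)
  else if (i ≤ᵇ n) ∧ (j ≡ᵇ part (flat la) i) then ((i ≤ᵇ k) ∧ (k ≤ᵇ n))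
  else (k ≡ᵇ n)

{-# OPTIONS --safe #-}
-- Row i ≤ n of T_max reads {i}, …, {i}, {i, …, n}, {n}, … with the corner {i, …, n} in
-- column λ♭_i, and rows below n are constantly {n}.  The sequence λ♭ drops by at least
-- one while it is positive, and every column j ≤ λ_p is either a corner column λ♭_i
-- with i ≤ p or lies strictly left of λ♭_p.  Hence the entry c occurs in column j exactly
-- when j ≤ λ♭_c or j = λ♭_i for some i < c.  Two consequences:
--   * every column containing m + 1 also contains m, so no column is (m+1)-pure and no
--     signature contains a − at all;
--   * r_c = λ♭_c + #{i < c | λ♭_i > 0} = λ♭_c + min (c − 1) k, which is the c-th entry
--     of λ̄⁽ⁿ⁾ because λ♭_c = 0 once c > k.
module Submission where

open import Defs
open import Data.Bool using (Bool; true; false; T; T?; not; _∧_; _∨_; if_then_else_)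
open import Data.Bool.ListAction using (any; all)
open import Data.Bool.Properties
  using (T-≡; T-∧; T-∨; T-not-≡; ⇔→≡; ∧-zeroʳ; ∨-identityʳ; ∨-commutativeMonoid)
open import Algebra.Bundles using (CommutativeMonoid)
open import Algebra.Properties.CommutativeSemigroup
  (CommutativeMonoid.commutativeSemigroup ∨-commutativeMonoid) using (x∙yz≈y∙xz)
open import Data.Empty using (⊥-elim)
open import Data.List using (List; []; _∷_; _++_; [_]; _∷ʳ_; map; length; filterᵇ; foldr; upTo)
open import Data.List.Membership.Propositional using (_∈_; _∉_; lose)
open import Data.List.Membership.Propositional.Properties
  using (∈-map⁺; ∈-map⁻; ∈-upTo⁺; ∈-upTo⁻; ∈-filter⁺; ∈-filter⁻; ∈-++⁻)
open import Data.List.Properties using (map-++; map-cong; map-cong-local; map-∘; upTo-∷ʳ)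
open import Data.List.Relation.Binary.Subset.Propositional using (_⊆_)
open import Data.List.Relation.Binary.Subset.Propositional.Properties using (∷⁺ʳ)
open import Data.List.Relation.Unary.All as All using (All; []; _∷_)
open import Data.List.Relation.Unary.All.Properties using (all⁺; ++⁻) renaming (map⁺ to All-map⁺)
open import Data.List.Relation.Unary.AllPairs using (AllPairs; _∷_)
open import Data.List.Relation.Unary.Any as Any using (here; there; satisfied)
open import Data.List.Relation.Unary.Any.Properties using (any⁺; any⁻)
open import Data.List.Relation.Unary.Linked as Linked using (Linked; []; [-]; _∷_)
open import Data.List.Relation.Unary.Linked.Properties using (Linked⇒AllPairs; applyUpTo⁺₁)
import Data.List.Relation.Unary.Linked.Properties as Linkedₚ
open import Data.Nat
  using (ℕ; zero; suc; _+_; _∸_; _⊓_; _≤_; _<_; _≥_; _≤′_; ≤′-refl; ≤′-step; _≤ᵇ_; _<ᵇ_; _≡ᵇ_; z≤n; s≤s)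
open import Data.Nat.Properties
open import Data.Product using (_×_; _,_; proj₁; proj₂; ∃; ∃-syntax)
open import Data.Sum using (_⊎_; inj₁; inj₂)
import Data.Sum as Sum
open import Data.Unit using (⊤)
open import Function using (id; _∘_)
open import Function.Bundles using (_⇔_; mk⇔; Equivalence)
open import Function.Properties.Equivalence using () renaming (trans to ⇔-trans; sym to ⇔-sym)
open import Relation.Binary.Definitions using (Transitive; tri<; tri≈; tri>)
open import Relation.Binary.PropositionalEquality
  using (_≡_; refl; sym; trans; cong; cong₂; subst; module ≡-Reasoning)
open import Relation.Nullary using (¬_; yes; no; proof)
open import Relation.Nullary.Decidable using (dec-true; dec-false)
open import Relation.Nullary.Reflects using (Reflects; ofʸ; ofⁿ)

open Equivalence using (to; from)

≡ᵇ-reflects-≡ : ∀ m n → Reflects (m ≡ n) (m ≡ᵇ n)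
≡ᵇ-reflects-≡ m n = proof (m ≟ n)

T-injective : ∀ {x y} → T x ⇔ T y → x ≡ y
T-injective x⇔y = ⇔→≡ (⇔-trans (⇔-sym T-≡) (⇔-trans x⇔y T-≡))

T-not⇒¬T : ∀ {b} → T (not b) → ¬ T b
T-not⇒¬T ¬b b = subst T (to T-not-≡ ¬b) b

T-≤ᵇ∨any-≡ᵇ : ∀ {j a vs} → T ((j ≤ᵇ a) ∨ any (j ≡ᵇ_) vs) ⇔ (j ≤ a ⊎ j ∈ vs)
T-≤ᵇ∨any-≡ᵇ {j} {a} {vs} = mk⇔
  (Sum.map (≤ᵇ⇒≤ j a) (Any.map (λ {v} → ≡ᵇ⇒≡ j v) ∘ any⁻ (j ≡ᵇ_) vs) ∘ to T-∨)
  (from T-∨ ∘ Sum.map ≤⇒≤ᵇ (any⁺ (j ≡ᵇ_) ∘ Any.map (λ {v} → ≡⇒≡ᵇ j v)))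

∈-oneTo⁺ : ∀ {n j} → 1 ≤ j → j ≤ n → j ∈ oneTo n
∈-oneTo⁺ {j = suc j} _ j<n = ∈-map⁺ suc (∈-upTo⁺ j<n)

∈-oneTo⁻ : ∀ {n j} → j ∈ oneTo n → 1 ≤ j × j ≤ n
∈-oneTo⁻ j∈ with _ , i∈ , refl ← ∈-map⁻ suc j∈ = s≤s z≤n , ∈-upTo⁻ i∈

All-oneTo : ∀ {P : ℕ → Set} {n} → (∀ {j} → 1 ≤ j → j ≤ n → P j) → All P (oneTo n)
All-oneTo P = All.tabulate λ j∈ → let 1≤j , j≤n = ∈-oneTo⁻ j∈ in P 1≤j j≤n

oneTo-∷ʳ : ∀ n → oneTo (suc n) ≡ oneTo n ∷ʳ suc n
oneTo-∷ʳ n = trans (cong (map suc) (sym (upTo-∷ʳ n))) (map-++ suc (upTo n) [ n ])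

-- Counting columns

count-++ : ∀ bs cs → count (bs ++ cs) ≡ count bs + count cs
count-++ []           cs = refl
count-++ (true  ∷ bs) cs = cong suc (count-++ bs cs)
count-++ (false ∷ bs) cs = count-++ bs cs

count-none : ∀ {A : Set} {p : A → Bool} {xs} → All (λ x → p x ≡ false) xs →
  count (map p xs) ≡ 0
count-none []         = refl
count-none (px ∷ pxs) rewrite px = count-none pxs

count-∨ : ∀ {A : Set} (e h : A → Bool) xs →
  count (map (λ x → e x ∨ h x) xs) ≡ count (map (λ x → e x ∧ not (h x)) xs) + count (map h xs)
count-∨ e h [] = refl
count-∨ e h (x ∷ xs) with e x | h x
... | true  | true  = trans (cong suc (count-∨ e h xs)) (sym (+-suc _ _))
... | true  | false = cong suc (count-∨ e h xs)
... | false | true  = trans (cong suc (count-∨ e h xs)) (sym (+-suc _ _))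
... | false | false = count-∨ e h xs

count-oneTo-suc : ∀ (p : ℕ → Bool) n →
  count (map p (oneTo (suc n))) ≡ count (map p (oneTo n)) + count [ p (suc n) ]
count-oneTo-suc p n = begin
  count (map p (oneTo (suc n)))            ≡⟨ cong (count ∘ map p) (oneTo-∷ʳ n) ⟩
  count (map p (oneTo n ++ [ suc n ]))     ≡⟨ cong count (map-++ p (oneTo n) [ suc n ]) ⟩
  count (map p (oneTo n) ++ [ p (suc n) ]) ≡⟨ count-++ (map p (oneTo n)) [ p (suc n) ] ⟩
  count (map p (oneTo n)) + count [ p (suc n) ] ∎
  where open ≡-Reasoning

count-cong-oneTo : ∀ {p q : ℕ → Bool} n → (∀ {j} → 1 ≤ j → j ≤ n → p j ≡ q j) →
  count (map p (oneTo n)) ≡ count (map q (oneTo n))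
count-cong-oneTo _ p≗q = cong count (map-cong-local (All-oneTo p≗q))

count-≤ᵇ-oneTo : ∀ a n → count (map (_≤ᵇ a) (oneTo n)) ≡ n ⊓ a
count-≤ᵇ-oneTo a zero    = refl
count-≤ᵇ-oneTo a (suc n) = begin
  count (map (_≤ᵇ a) (oneTo (suc n)))                  ≡⟨ count-oneTo-suc (_≤ᵇ a) n ⟩
  count (map (_≤ᵇ a) (oneTo n)) + count [ suc n ≤ᵇ a ]
    ≡⟨ cong (_+ count [ suc n ≤ᵇ a ]) (count-≤ᵇ-oneTo a n) ⟩
  n ⊓ a + count [ suc n ≤ᵇ a ]                         ≡⟨ grow ⟩
  suc n ⊓ a                                            ∎
  where
  open ≡-Reasoning
  grow : n ⊓ a + count [ suc n ≤ᵇ a ] ≡ suc n ⊓ a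
  grow with <-≤-connex n a
  ... | inj₁ n<a
    rewrite dec-true (suc n ≤? a) n<a | m≤n⇒m⊓n≡m n<a | m≤n⇒m⊓n≡m (<⇒≤ n<a) = +-comm n 1
  ... | inj₂ a≤n
    rewrite dec-false (suc n ≤? a) (≤⇒≯ a≤n) | m≥n⇒m⊓n≡n a≤n | m≥n⇒m⊓n≡n (m≤n⇒m≤1+n a≤n) = +-identityʳ a

count-≡ᵇ-oneTo : ∀ {v n} → 1 ≤ v → v ≤ n → count (map (_≡ᵇ v) (oneTo n)) ≡ 1
count-≡ᵇ-oneTo {suc v} {zero} _ ()
count-≡ᵇ-oneTo {v} {suc n} 1≤v v≤1+n =
  trans (count-oneTo-suc (_≡ᵇ v) n) (last-or-earlier (m≤n⇒m<n∨m≡n v≤1+n))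
  where
  last-or-earlier : v < suc n ⊎ v ≡ suc n →
    count (map (_≡ᵇ v) (oneTo n)) + count [ suc n ≡ᵇ v ] ≡ 1
  last-or-earlier (inj₁ v≤n) rewrite dec-false (suc n ≟ v) (>⇒≢ v≤n) =
    trans (+-identityʳ _) (count-≡ᵇ-oneTo 1≤v (≤-pred v≤n))
  last-or-earlier (inj₂ refl) rewrite dec-true (suc n ≟ suc n) refl =
    cong (_+ 1) (count-none (All-oneTo λ _ j≤n → dec-false (_ ≟ suc n) (<⇒≢ (s≤s j≤n))))

infix 4 _⋗_

-- v < u, except that 0 ⋗ 0 by truncated subtraction: λ♭ drops like this until it reaches 0.
_⋗_ : ℕ → ℕ → Set
u ⋗ v = v ≤ u ∸ 1

⋗-trans : Transitive _⋗_
⋗-trans {_} {v} v≤u-1 w≤v-1 = ≤-trans w≤v-1 (≤-trans (m∸n≤m v 1) v≤u-1)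

⋗⇒> : ∀ {u v} → u ⋗ v → 0 < v → v < u
⋗⇒> {zero}  v≤0 0<v = ⊥-elim (<⇒≱ 0<v v≤0)
⋗⇒> {suc u} v≤u _   = s≤s v≤u

<⇒⋗ : ∀ {u v} → v < u → u ⋗ v
<⇒⋗ (s≤s v≤u) = v≤u

-- Each positive value lies right of a and of all later values, so it adds exactly one column.
count-columns : ∀ {L a} vs → All (_≤ L) (vs ∷ʳ a) → AllPairs _⋗_ (vs ∷ʳ a) →
  count (map (λ j → (j ≤ᵇ a) ∨ any (j ≡ᵇ_) vs) (oneTo L)) ≡ a + count (map (1 ≤ᵇ_) vs)
count-columns {L} {a} [] (a≤L ∷ []) _ = begin
  count (map (λ j → (j ≤ᵇ a) ∨ false) (oneTo L))
    ≡⟨ cong count (map-cong (λ j → ∨-identityʳ (j ≤ᵇ a)) (oneTo L)) ⟩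
  count (map (_≤ᵇ a) (oneTo L)) ≡⟨ count-≤ᵇ-oneTo a L ⟩
  L ⊓ a                         ≡⟨ m≥n⇒m⊓n≡n a≤L ⟩
  a                             ≡⟨ +-identityʳ a ⟨
  a + 0                         ∎
  where open ≡-Reasoning
count-columns {L} (zero ∷ vs) (_ ∷ ≤L) (_ ∷ ⋗s) =
  trans (count-cong-oneTo L λ { {suc j} _ _ → refl }) (count-columns vs ≤L ⋗s)
count-columns {L} {a} (suc w ∷ vs) (v≤L ∷ ≤L) (v⋗ ∷ ⋗s) = begin
  count (map (λ j → (j ≤ᵇ a) ∨ ((j ≡ᵇ suc w) ∨ any (j ≡ᵇ_) vs)) (oneTo L))
    ≡⟨ cong count (map-cong (λ j → x∙yz≈y∙xz (j ≤ᵇ a) (j ≡ᵇ suc w) _) (oneTo L)) ⟩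
  count (map (λ j → (j ≡ᵇ suc w) ∨ earlier j) (oneTo L))
    ≡⟨ count-∨ (_≡ᵇ suc w) earlier (oneTo L) ⟩
  count (map (λ j → (j ≡ᵇ suc w) ∧ not (earlier j)) (oneTo L)) + count (map earlier (oneTo L))
    ≡⟨ cong₂ _+_ (trans (cong count (map-cong new (oneTo L))) (count-≡ᵇ-oneTo (s≤s z≤n) v≤L))
                 (count-columns vs ≤L ⋗s) ⟩
  suc (a + count (map (1 ≤ᵇ_) vs))
    ≡⟨ +-suc a _ ⟨
  a + suc (count (map (1 ≤ᵇ_) vs)) ∎
  where
  open ≡-Reasoning
  earlier : ℕ → Bool
  earlier j = (j ≤ᵇ a) ∨ any (j ≡ᵇ_) vs
  below : All (_≤ w) vs × All (_≤ w) [ a ]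
  below = ++⁻ vs v⋗
  unseen : ¬ T (earlier (suc w))
  unseen t with to T-≤ᵇ∨any-≡ᵇ t | below
  ... | inj₁ w<a  | _ , a≤w ∷ [] = <⇒≱ w<a a≤w
  ... | inj₂ w+1∈ | vs≤w , _     = 1+n≰n (All.lookup vs≤w w+1∈)
  new : ∀ j → (j ≡ᵇ suc w) ∧ not (earlier j) ≡ (j ≡ᵇ suc w)
  new j with j ≡ᵇ suc w | ≡ᵇ-reflects-≡ j (suc w)
  ... | false | _        = refl
  ... | true  | ofʸ refl = cong not (dec-false (T? _) unseen)

-- Entries of lists and λ♭

part-pos⇒≤length : ∀ xs {i} → 0 < part xs i → i ≤ length xs
part-pos⇒≤length (x ∷ xs) {suc zero}    _   = s≤s z≤n
part-pos⇒≤length (x ∷ xs) {suc (suc i)} pos = s≤s (part-pos⇒≤length xs pos)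

part-suc-≤ : ∀ {xs} → Linked _≥_ xs → ∀ i → part xs (suc (suc i)) ≤ part xs (suc i)
part-suc-≤ {[]}          _         _       = z≤n
part-suc-≤ {x ∷ []}      _         _       = z≤n
part-suc-≤ {x ∷ y ∷ ys}  (x≥y ∷ _) zero    = x≥y
part-suc-≤ {x ∷ y ∷ ys}  (_ ∷ ys≥) (suc i) = part-suc-≤ ys≥ i

part-antitone : ∀ {xs} → Linked _≥_ xs → ∀ {i i'} → 1 ≤ i → i ≤ i' → part xs i' ≤ part xs i
part-antitone {xs} xs≥ {i} 1≤i = go ∘ ≤⇒≤′
  where
  go : ∀ {i'} → i ≤′ i' → part xs i' ≤ part xs i
  go ≤′-refl                    = ≤-refl
  go (≤′-step {zero}  i≤′0)     = ⊥-elim (<⇒≱ 1≤i (≤′⇒≤ i≤′0))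
  go (≤′-step {suc k} i≤′k+1)   = ≤-trans (part-suc-≤ xs≥ k) (go i≤′k+1)

⋗-zeros : ∀ {xs} → Linked _⋗_ (0 ∷ xs) → All (_≡ 0) xs
⋗-zeros [-]         = []
⋗-zeros (z≤n ∷ 0⋗s) = refl ∷ ⋗-zeros 0⋗s

part-zeros : ∀ {xs} → All (_≡ 0) xs → ∀ i → part xs i ≡ 0
part-zeros []           _             = refl
part-zeros (_    ∷ _)   zero          = refl
part-zeros (refl ∷ _)   (suc zero)    = refl
part-zeros (_    ∷ zs)  (suc (suc i)) = part-zeros zs (suc i)

length-filter-zeros : ∀ {xs} → All (_≡ 0) xs → length (filterᵇ (1 ≤ᵇ_) xs) ≡ 0
length-filter-zeros []          = refl
length-filter-zeros (refl ∷ zs) = length-filter-zeros zs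

positive-prefix : ∀ {xs} → Linked _⋗_ xs → ∀ i →
  (1 ≤ᵇ part xs (suc i)) ≡ (suc i ≤ᵇ length (filterᵇ (1 ≤ᵇ_) xs))
positive-prefix {[]}         _    _       = refl
positive-prefix {suc x ∷ xs} _    zero    = refl
positive-prefix {suc x ∷ xs} x⋗xs (suc i) = positive-prefix (Linked.tail x⋗xs) i
positive-prefix {zero ∷ xs}  0⋗xs i
  rewrite part-zeros (refl ∷ ⋗-zeros 0⋗xs) (suc i) | length-filter-zeros (⋗-zeros 0⋗xs) = refl

λ♭ : List ℕ → ℕ → ℕ
λ♭ la = part (flat la)

λ♭-head : ∀ la → λ♭ la 1 ≡ part la 1
λ♭-head []      = refl
λ♭-head (_ ∷ _) = refl

flatGo-suc : ∀ p xs i →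
  part (p ∷ flatGo p xs) (suc (suc i))
    ≡ (part (p ∷ flatGo p xs) (suc i) ∸ 1) ⊓ part (p ∷ xs) (suc (suc i))
flatGo-suc p []       i       = sym (⊓-zeroʳ _)
flatGo-suc p (x ∷ xs) zero    = refl
flatGo-suc p (x ∷ xs) (suc i) = flatGo-suc ((p ∸ 1) ⊓ x) xs i

λ♭-suc : ∀ la i → λ♭ la (suc (suc i)) ≡ (λ♭ la (suc i) ∸ 1) ⊓ part la (suc (suc i))
λ♭-suc []       _ = refl
λ♭-suc (x ∷ xs) i = flatGo-suc x xs i

flat-⋗ : ∀ la → Linked _⋗_ (flat la)
flat-⋗ []       = []
flat-⋗ (x ∷ xs) = flatGo-⋗ x xs
  where
  flatGo-⋗ : ∀ p xs → Linked _⋗_ (p ∷ flatGo p xs)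
  flatGo-⋗ p []       = [-]
  flatGo-⋗ p (x ∷ xs) = m⊓n≤m _ _ ∷ flatGo-⋗ _ xs

λ♭-⋗ : ∀ la {i} → 1 ≤ i → λ♭ la i ⋗ λ♭ la (suc i)
λ♭-⋗ la {suc i} _ = subst (_≤ λ♭ la (suc i) ∸ 1) (sym (λ♭-suc la i)) (m⊓n≤m _ _)

λ♭-suc-≤ : ∀ la {i} → 1 ≤ i → λ♭ la (suc i) ≤ λ♭ la i
λ♭-suc-≤ la 1≤i = ≤-trans (λ♭-⋗ la 1≤i) (m∸n≤m _ 1)

λ♭-≤ : ∀ la {i} → 1 ≤ i → λ♭ la i ≤ part la i
λ♭-≤ la {suc zero}    _ = ≤-reflexive (λ♭-head la)
λ♭-≤ la {suc (suc i)} _ = subst (_≤ part la (suc (suc i))) (sym (λ♭-suc la i)) (m⊓n≤n _ _)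

λ♭-descending : ∀ la n → Linked _⋗_ (map (λ♭ la) (oneTo n))
λ♭-descending la n = Linkedₚ.map⁺ (Linkedₚ.map⁺ (applyUpTo⁺₁ id n λ _ → λ♭-⋗ la (s≤s z≤n)))

λ♭-cover : ∀ {la} → Linked _≥_ la → ∀ {p j} → 1 ≤ p → j ≤ part la p →
  (∃[ i ] 1 ≤ i × i ≤ p × λ♭ la i ≡ j) ⊎ j < λ♭ la p
λ♭-cover {la} _ {suc zero} {j} _ j≤λ₁
  with m≤n⇒m<n∨m≡n (subst (j ≤_) (sym (λ♭-head la)) j≤λ₁)
... | inj₁ j<λ♭₁ = inj₂ j<λ♭₁
... | inj₂ j≡λ♭₁ = inj₁ (1 , ≤-refl , ≤-refl , sym j≡λ♭₁)
λ♭-cover {la} la≥ {suc (suc p)} {j} _ j≤λ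
  with λ♭-cover la≥ (s≤s z≤n) (≤-trans j≤λ (part-suc-≤ la≥ p))
... | inj₁ (i , 1≤i , i≤p , λ♭i≡j) = inj₁ (i , 1≤i , m≤n⇒m≤1+n i≤p , λ♭i≡j)
... | inj₂ j<λ♭p with m≤n⇒m<n∨m≡n (subst (j ≤_) (sym (λ♭-suc la p)) (⊓-glb (<⇒⋗ j<λ♭p) j≤λ))
...   | inj₁ j<λ♭ = inj₂ j<λ♭
...   | inj₂ j≡λ♭ = inj₁ (suc (suc p) , s≤s z≤n , ≤-refl , sym j≡λ♭)

-- The columns of T_max holding the entry k + 1: those of its own row up to λ♭_{k+1},
-- and the corner columns λ♭_i of the rows i ≤ k.
TmaxColumn : List ℕ → ℕ → ℕ → Set
TmaxColumn la k j = j ≤ λ♭ la (suc k) ⊎ j ∈ map (λ♭ la) (oneTo k)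

corner-TmaxColumn : ∀ la {i k} → 1 ≤ i → i ≤ suc k → TmaxColumn la k (λ♭ la i)
corner-TmaxColumn la 1≤i i≤k+1 with m≤n⇒m<n∨m≡n i≤k+1
... | inj₁ (s≤s i≤k) = inj₂ (∈-map⁺ (λ♭ la) (∈-oneTo⁺ 1≤i i≤k))
... | inj₂ refl      = inj₁ ≤-refl

-- Columns and signatures of a filling

inBox⁻ : ∀ la i j → T (inBox la i j) → 1 ≤ i × i ≤ length la × 1 ≤ j × j ≤ part la i
inBox⁻ la i j box =
  let 1≤i , box₁ = to T-∧ box
      i≤ℓ , box₂ = to T-∧ box₁
      1≤j , j≤λᵢ = to T-∧ box₂
  in ≤ᵇ⇒≤ 1 i 1≤i , ≤ᵇ⇒≤ i (length la) i≤ℓ , ≤ᵇ⇒≤ 1 j 1≤j , ≤ᵇ⇒≤ j (part la i) j≤λᵢ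

inBox⁺ : ∀ la i {j} → 1 ≤ i → 1 ≤ j → j ≤ part la i → T (inBox la i j)
inBox⁺ la i 1≤i 1≤j j≤λᵢ =
  from T-∧ (≤⇒≤ᵇ 1≤i , from T-∧ (≤⇒≤ᵇ i≤ℓ , from T-∧ (≤⇒≤ᵇ 1≤j , ≤⇒≤ᵇ j≤λᵢ)))
  where i≤ℓ = part-pos⇒≤length la (≤-trans 1≤j j≤λᵢ)

ColumnHas : List ℕ → Filling → ℕ → ℕ → Set
ColumnHas la U j k = ∃[ i ] T (inBox la i j) × T (U i j k)

columnHasᵇ : List ℕ → Filling → ℕ → ℕ → Bool
columnHasᵇ la U j k = any (λ i → inBox la i j ∧ U i j k) (oneTo (length la))

T-columnHasᵇ : ∀ {la U j k} → T (columnHasᵇ la U j k) ⇔ ColumnHas la U j k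
T-columnHasᵇ {la} {U} {j} {k} = mk⇔ found place
  where
  cell : ℕ → Bool
  cell i = inBox la i j ∧ U i j k
  found : T (columnHasᵇ la U j k) → ColumnHas la U j k
  found t with i , cellᵢ ← satisfied (any⁻ cell (oneTo (length la)) t) =
    i , to (T-∧ {inBox la i j}) cellᵢ
  place : ColumnHas la U j k → T (columnHasᵇ la U j k)
  place (i , box , u) with 1≤i , i≤ℓ , _ ← inBox⁻ la i j box =
    any⁺ cell (lose (∈-oneTo⁺ {length la} 1≤i i≤ℓ) (from (T-∧ {inBox la i j}) (box , u)))

meets : List ℕ → Filling → ℕ → ℕ → ℕ → Bool
meets la U m j i = inBox la i j ∧ (U i j m ∨ U i j (suc m))

columnRows : List ℕ → Filling → ℕ → ℕ → List ℕ
columnRows la U m j = filterᵇ (meets la U m j) (oneTo (length la))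

minus∈colSign⇒pure : ∀ la U m j → minus ∈ colSign la U m j →
  ∃[ r ] r ∈ columnRows la U m j ×
         T (all (λ i → not (U i j m) ∧ U i j (suc m)) (columnRows la U m j))
minus∈colSign⇒pure la U m j minus∈ with columnRows la U m j
minus∈colSign⇒pure la U m j () | []
... | r ∷ rs with all (λ i → U i j m ∧ not (U i j (suc m))) (r ∷ rs)
minus∈colSign⇒pure la U m j (here ())  | r ∷ rs | true
minus∈colSign⇒pure la U m j (there ()) | r ∷ rs | true
... | false with all (λ i → not (U i j m) ∧ U i j (suc m)) (r ∷ rs)
...   | true = r , here refl , _
minus∈colSign⇒pure la U m j () | r ∷ rs | false | false

minus∈colSign⁻ : ∀ {la U m j} → minus ∈ colSign la U m j →
  ColumnHas la U j (suc m) × ¬ ColumnHas la U j m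
minus∈colSign⁻ {la} {U} {m} {j} minus∈ = has-m+1 , lacks-m
  where
  rows = columnRows la U m j
  nonempty-and-pure = minus∈colSign⇒pure la U m j minus∈
  pure : ∀ {i} → i ∈ rows → T (not (U i j m) ∧ U i j (suc m))
  pure = All.lookup (all⁺ _ rows (proj₂ (proj₂ nonempty-and-pure)))
  has-m+1 : ColumnHas la U j (suc m)
  has-m+1 = let r , r∈ , _ = nonempty-and-pure in
    r , proj₁ (to T-∧ (proj₂ (∈-filter⁻ (T? ∘ meets la U m j) {xs = oneTo (length la)} r∈))) ,
    proj₂ (to T-∧ (pure r∈))
  lacks-m : ¬ ColumnHas la U j m
  lacks-m (i , box , u) =
    let 1≤i , i≤ℓ , _ = inBox⁻ la i j box
        i∈ = ∈-filter⁺ (T? ∘ meets la U m j) (∈-oneTo⁺ {length la} 1≤i i≤ℓ)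
               (from (T-∧ {inBox la i j}) (box , from T-∨ (inj₁ u)))
    in T-not⇒¬T (proj₁ (to T-∧ (pure i∈))) u

Shrinks : List Sign → Step → Set
Shrinks s done         = ⊤
Shrinks s (changed s') = s' ⊆ s

cancelOnce-shrinks : ∀ s → Shrinks s (cancelOnce s)
cancelOnce-shrinks []                 = _
cancelOnce-shrinks (minus ∷ [])       = _
cancelOnce-shrinks (minus ∷ plus ∷ s) = there ∘ there
cancelOnce-shrinks (minus ∷ minus ∷ s) with cancelOnce (minus ∷ s) | cancelOnce-shrinks (minus ∷ s)
... | done       | _     = _
... | changed s' | s'⊆s = ∷⁺ʳ minus s'⊆s
cancelOnce-shrinks (plus ∷ s) with cancelOnce s | cancelOnce-shrinks s
... | done       | _     = _
... | changed s' | s'⊆s = ∷⁺ʳ plus s'⊆s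

cancelIter-⊆ : ∀ fuel s → cancelIter fuel s ⊆ s
cancelIter-⊆ zero       s = id
cancelIter-⊆ (suc fuel) s with cancelOnce s | cancelOnce-shrinks s
... | done       | _     = id
... | changed s' | s'⊆s = s'⊆s ∘ cancelIter-⊆ fuel s'

reduced-⊆ : ∀ s → reduced s ⊆ s
reduced-⊆ s = cancelIter-⊆ (length s) s

∈-signature⁻ : ∀ {la U m x} → x ∈ signature la U m → ∃[ j ] x ∈ colSign la U m j
∈-signature⁻ {la} {U} {m} = go (oneTo (part la 1))
  where
  go : ∀ {x} js → x ∈ foldr (λ j s → colSign la U m j ++ s) [] js → ∃[ j ] x ∈ colSign la U m j
  go (j ∷ js) x∈ with ∈-++⁻ (colSign la U m j) x∈
  ... | inj₁ x∈colⱼ = j , x∈colⱼ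
  ... | inj₂ x∈rest = go js x∈rest

minus∉reduced-signature : ∀ {la U m} → (∀ {j} → ColumnHas la U j (suc m) → ColumnHas la U j m) →
  minus ∉ reduced (signature la U m)
minus∉reduced-signature {la} {U} {m} descends minus∈
  with j , minus∈colⱼ ← ∈-signature⁻ {la} {U} {m} (reduced-⊆ (signature la U m) minus∈)
  with has-m+1 , lacks-m ← minus∈colSign⁻ {la} {U} {m} {j} minus∈colⱼ
  = lacks-m (descends has-m+1)

-- T_max

module _ (n : ℕ) (la : List ℕ) where

  data InTmax (i j k : ℕ) : Set where
    left    : i ≤ n → j < λ♭ la i → k ≡ i → InTmax i j k
    corner  : i ≤ n → j ≡ λ♭ la i → i ≤ k → k ≤ n → InTmax i j k
    outside : n < i ⊎ λ♭ la i < j → k ≡ n → InTmax i j k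

  InTmax⁻ : ∀ i j k → T (Tmax n la i j k) → InTmax i j k
  InTmax⁻ i j k k∈
    with i ≤ᵇ n      | ≤ᵇ-reflects-≤ i n
       | j <ᵇ λ♭ la i | <ᵇ-reflects-< j (λ♭ la i)
       | j ≡ᵇ λ♭ la i | ≡ᵇ-reflects-≡ j (λ♭ la i)
  ... | false | ofⁿ i≰n | _     | _       | _     | _       = outside (inj₁ (≰⇒> i≰n)) (≡ᵇ⇒≡ k n k∈)
  ... | true  | ofʸ i≤n | true  | ofʸ j<λ♭ | _     | _       = left i≤n j<λ♭ (≡ᵇ⇒≡ k i k∈)
  ... | true  | ofʸ i≤n | false | _       | true  | ofʸ j≡λ♭ =
    let i≤k , k≤n = to T-∧ k∈ in corner i≤n j≡λ♭ (≤ᵇ⇒≤ i k i≤k) (≤ᵇ⇒≤ k n k≤n)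
  ... | true  | ofʸ i≤n | false | ofⁿ j≮λ♭ | false | ofⁿ j≢λ♭ =
    outside (inj₂ (≤∧≢⇒< (≮⇒≥ j≮λ♭) (j≢λ♭ ∘ sym))) (≡ᵇ⇒≡ k n k∈)

  InTmax⁺ : ∀ {i j k} → InTmax i j k → T (Tmax n la i j k)
  InTmax⁺ {i} {j} (left i≤n j<λ♭ refl)
    rewrite dec-true (i ≤? n) i≤n | dec-true (j <? λ♭ la i) j<λ♭ = ≡⇒≡ᵇ i i refl
  InTmax⁺ {i} {j} (corner i≤n j≡λ♭ i≤k k≤n)
    rewrite dec-true (i ≤? n) i≤n | dec-false (j <? λ♭ la i) (<-irrefl j≡λ♭) | dec-true (j ≟ λ♭ la i) j≡λ♭
    = from T-∧ (≤⇒≤ᵇ i≤k , ≤⇒≤ᵇ k≤n)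
  InTmax⁺ {i} {j} (outside (inj₁ n<i) refl)
    rewrite dec-false (i ≤? n) (<⇒≱ n<i) = ≡⇒≡ᵇ n n refl
  InTmax⁺ {i} {j} (outside (inj₂ λ♭<j) refl)
    rewrite dec-false (j <? λ♭ la i) (<⇒≯ λ♭<j) | dec-false (j ≟ λ♭ la i) (>⇒≢ λ♭<j) | ∧-zeroʳ (i ≤ᵇ n)
    = ≡⇒≡ᵇ n n refl

  InTmax-inhabited : ∀ i j → ∃[ k ] InTmax i j k
  InTmax-inhabited i j with i ≤? n | <-cmp j (λ♭ la i)
  ... | no i≰n | _                = n , outside (inj₁ (≰⇒> i≰n)) refl
  ... | yes i≤n | tri< j<λ♭ _ _   = i , left i≤n j<λ♭ refl
  ... | yes i≤n | tri≈ _ j≡λ♭ _   = i , corner i≤n j≡λ♭ ≤-refl i≤n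
  ... | yes _   | tri> _ _ λ♭<j   = n , outside (inj₂ λ♭<j) refl

  InTmax-bounds : ∀ {i j k} → 1 ≤ i → 1 ≤ n → InTmax i j k → 1 ≤ k × k ≤ n
  InTmax-bounds 1≤i _   (left i≤n _ refl)      = 1≤i , i≤n
  InTmax-bounds 1≤i _   (corner _ _ i≤k k≤n)   = ≤-trans 1≤i i≤k , k≤n
  InTmax-bounds _   1≤n (outside _ refl)       = 1≤n , ≤-refl

  InTmax-≤ : ∀ {i j k} → InTmax i j k → k ≤ n
  InTmax-≤ (left i≤n _ refl)    = i≤n
  InTmax-≤ (corner _ _ _ k≤n)   = k≤n
  InTmax-≤ (outside _ refl)     = ≤-refl

  InTmax-left : ∀ {i j k} → i ≤ n → j < λ♭ la i → InTmax i j k → k ≡ i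
  InTmax-left _   _    (left _ _ k≡i)                = k≡i
  InTmax-left _   j<λ♭ (corner _ j≡λ♭ _ _)          = ⊥-elim (<-irrefl j≡λ♭ j<λ♭)
  InTmax-left i≤n _    (outside (inj₁ n<i) _)        = ⊥-elim (<⇒≱ n<i i≤n)
  InTmax-left _   j<λ♭ (outside (inj₂ λ♭<j) _)       = ⊥-elim (<-asym j<λ♭ λ♭<j)

  svrpp-Tmax : 1 ≤ n → SVRPP n la (Tmax n la)
  svrpp-Tmax 1≤n = entries , rows , columns
    where
    entries : ∀ i j → inBox la i j ≡ true →
      (∀ k → Tmax n la i j k ≡ true → 1 ≤ k × k ≤ n) × ∃ (λ k → Tmax n la i j k ≡ true)
    entries i j box =
      (λ k k∈ → InTmax-bounds (proj₁ (inBox⁻ la i j (from T-≡ box))) 1≤n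
                                (InTmax⁻ i j k (from T-≡ k∈))) ,
      (let k , k∈ = InTmax-inhabited i j in k , to T-≡ (InTmax⁺ k∈))

    rows : ∀ i j → inBox la i j ≡ true → inBox la i (suc j) ≡ true →
      ∀ a b → Tmax n la i j a ≡ true → Tmax n la i (suc j) b ≡ true → a ≤ b
    rows i j _ _ a b a∈ b∈ with InTmax⁻ i (suc j) b (from T-≡ b∈) | InTmax⁻ i j a (from T-≡ a∈)
    ... | left i≤n j+1<λ♭ refl     | a∈ᵢⱼ =
      ≤-reflexive (InTmax-left i≤n (<-trans (n<1+n j) j+1<λ♭) a∈ᵢⱼ)
    ... | corner i≤n j+1≡λ♭ i≤b _ | a∈ᵢⱼ =
      ≤-trans (≤-reflexive (InTmax-left i≤n (≤-reflexive j+1≡λ♭) a∈ᵢⱼ)) i≤b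
    ... | outside _ refl          | a∈ᵢⱼ = InTmax-≤ a∈ᵢⱼ

    columns : ∀ i j → inBox la i j ≡ true → inBox la (suc i) j ≡ true →
      ∀ a b → Tmax n la i j a ≡ true → Tmax n la (suc i) j b ≡ true → a ≤ b
    columns i j box _ a b a∈ b∈
      with 1≤i , _ , 1≤j , _ ← inBox⁻ la i j (from T-≡ box)
      with InTmax⁻ (suc i) j b (from T-≡ b∈) | InTmax⁻ i j a (from T-≡ a∈)
    ... | left i+1≤n j<λ♭ refl | a∈ᵢⱼ =
      let j<λ♭ᵢ = <-≤-trans j<λ♭ (λ♭-suc-≤ la 1≤i) in
      ≤-trans (≤-reflexive (InTmax-left (<⇒≤ i+1≤n) j<λ♭ᵢ a∈ᵢⱼ)) (n≤1+n i)
    ... | corner i+1≤n refl i+1≤b _ | a∈ᵢⱼ =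
      let j<λ♭ = ⋗⇒> (λ♭-⋗ la 1≤i) 1≤j in
      ≤-trans (≤-reflexive (InTmax-left (<⇒≤ i+1≤n) j<λ♭ a∈ᵢⱼ)) (≤-trans (n≤1+n i) i+1≤b)
    ... | outside _ refl | a∈ᵢⱼ = InTmax-≤ a∈ᵢⱼ

  module _ (la≥ : Linked _≥_ la) where

    column-Tmax : ∀ {j k} → 1 ≤ j → suc k ≤ n →
      ColumnHas la (Tmax n la) j (suc k) ⇔ TmaxColumn la k j
    column-Tmax {j} {k} 1≤j k+1≤n = mk⇔ occupied occupant
      where
      corner-value : ∀ {p} → p ≤ suc k → (∃[ i ] 1 ≤ i × i ≤ p × λ♭ la i ≡ j) → TmaxColumn la k j
      corner-value p≤k+1 (i , 1≤i , i≤p , refl) = corner-TmaxColumn la 1≤i (≤-trans i≤p p≤k+1)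

      outside-box : ∀ {i} → 1 ≤ i → j ≤ part la i → n < i ⊎ λ♭ la i < j → suc k ≡ n →
        TmaxColumn la k j
      outside-box {i} 1≤i j≤λᵢ beyond refl with i ≤? n
      ... | no i≰n
        with λ♭-cover la≥ (s≤s z≤n) (≤-trans j≤λᵢ (part-antitone la≥ (s≤s z≤n) (<⇒≤ (≰⇒> i≰n))))
      ...   | inj₁ found = corner-value ≤-refl found
      ...   | inj₂ j<λ♭ₙ = inj₁ (<⇒≤ j<λ♭ₙ)
      outside-box {i} 1≤i j≤λᵢ beyond refl | yes i≤n with beyond | λ♭-cover la≥ 1≤i j≤λᵢ
      ... | inj₁ n<i  | _           = ⊥-elim (<⇒≱ n<i i≤n)
      ... | inj₂ _    | inj₁ found  = corner-value i≤n found
      ... | inj₂ λ♭<j | inj₂ j<λ♭   = ⊥-elim (<-asym λ♭<j j<λ♭)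

      occupied : ColumnHas la (Tmax n la) j (suc k) → TmaxColumn la k j
      occupied (i , box , k+1∈)
        with 1≤i , _ , _ , j≤λᵢ ← inBox⁻ la i j box | InTmax⁻ i j (suc k) k+1∈
      ... | left _ j<λ♭ refl          = inj₁ (<⇒≤ j<λ♭)
      ... | corner _ refl i≤k+1 _    = corner-TmaxColumn la 1≤i i≤k+1
      ... | outside beyond k+1≡n     = outside-box 1≤i j≤λᵢ beyond k+1≡n

      occupant : TmaxColumn la k j → ColumnHas la (Tmax n la) j (suc k)
      occupant (inj₁ j≤λ♭) =
        suc k , inBox⁺ la (suc k) (s≤s z≤n) 1≤j (≤-trans j≤λ♭ (λ♭-≤ la (s≤s z≤n))) , InTmax⁺ row
        where
        row : InTmax (suc k) j (suc k)
        row with m≤n⇒m<n∨m≡n j≤λ♭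
        ... | inj₁ j<λ♭ = left k+1≤n j<λ♭ refl
        ... | inj₂ j≡λ♭ = corner k+1≤n j≡λ♭ ≤-refl k+1≤n
      occupant (inj₂ j∈) with i , i∈ , refl ← ∈-map⁻ (λ♭ la) j∈ with 1≤i , i≤k ← ∈-oneTo⁻ i∈ =
        let i≤k+1 = m≤n⇒m≤1+n i≤k in
        i , inBox⁺ la i 1≤i 1≤j (λ♭-≤ la 1≤i) , InTmax⁺ (corner (≤-trans i≤k+1 k+1≤n) refl i≤k+1 k+1≤n)

    column-Tmax-descends : ∀ {j m} → 1 ≤ m → suc m ≤ n →
      ColumnHas la (Tmax n la) j (suc m) → ColumnHas la (Tmax n la) j m
    column-Tmax-descends {j} {suc m} _ m+2≤n has@(i , box , _) =
      from (column-Tmax 1≤j (<⇒≤ m+2≤n)) (lower (to (column-Tmax 1≤j m+2≤n) has))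
      where
      1≤j = proj₁ (proj₂ (proj₂ (inBox⁻ la i j box)))
      lower : TmaxColumn la (suc m) j → TmaxColumn la m j
      lower (inj₁ j≤λ♭) = inj₁ (≤-trans j≤λ♭ (λ♭-suc-≤ la (s≤s z≤n)))
      lower (inj₂ j∈) with i , i∈ , refl ← ∈-map⁻ (λ♭ la) j∈ with 1≤i , i≤m+1 ← ∈-oneTo⁻ i∈ =
        corner-TmaxColumn la 1≤i i≤m+1

    highestWeight-Tmax : 1 ≤ n → HighestWeight n la (Tmax n la)
    highestWeight-Tmax 1≤n = svrpp-Tmax 1≤n , λ m 1≤m m≤n-1 →
      minus∉reduced-signature {la} {Tmax n la} {m} (column-Tmax-descends 1≤m (⋗⇒> m≤n-1 1≤m))

    columnHasᵇ-Tmax : ∀ {j k} → 1 ≤ j → suc k ≤ n →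
      columnHasᵇ la (Tmax n la) j (suc k) ≡ (j ≤ᵇ λ♭ la (suc k)) ∨ any (j ≡ᵇ_) (map (λ♭ la) (oneTo k))
    columnHasᵇ-Tmax {j} {k} 1≤j k+1≤n = T-injective
      (⇔-trans (T-columnHasᵇ {la} {Tmax n la} {j} {suc k})
      (⇔-trans (column-Tmax 1≤j k+1≤n)
               (⇔-sym (T-≤ᵇ∨any-≡ᵇ {j} {λ♭ la (suc k)} {map (λ♭ la) (oneTo k)}))))

    ircontAt-Tmax : ∀ {k} → suc k ≤ n →
      ircontAt la (Tmax n la) (suc k) ≡ λ♭ la (suc k) + k ⊓ kOf la
    ircontAt-Tmax {k} k+1≤n = begin
      ircontAt la (Tmax n la) (suc k)
        ≡⟨ count-cong-oneTo (part la 1) (λ 1≤j _ → columnHasᵇ-Tmax 1≤j k+1≤n) ⟩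
      count (map (λ j → (j ≤ᵇ λ♭ la (suc k)) ∨ any (j ≡ᵇ_) corners) (oneTo (part la 1)))
        ≡⟨ count-columns corners bounded descending ⟩
      λ♭ la (suc k) + count (map (1 ≤ᵇ_) corners)
        ≡⟨ cong (λ♭ la (suc k) +_) positives ⟩
      λ♭ la (suc k) + k ⊓ kOf la ∎
      where
      open ≡-Reasoning
      corners = map (λ♭ la) (oneTo k)
      corners-∷ʳ : corners ∷ʳ λ♭ la (suc k) ≡ map (λ♭ la) (oneTo (suc k))
      corners-∷ʳ =
        sym (trans (cong (map (λ♭ la)) (oneTo-∷ʳ k)) (map-++ (λ♭ la) (oneTo k) [ suc k ]))
      bounded : All (_≤ part la 1) (corners ∷ʳ λ♭ la (suc k))
      bounded rewrite corners-∷ʳ =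
        All-map⁺ (All-oneTo λ 1≤i _ → ≤-trans (λ♭-≤ la 1≤i) (part-antitone la≥ (s≤s z≤n) 1≤i))
      descending : AllPairs _⋗_ (corners ∷ʳ λ♭ la (suc k))
      descending rewrite corners-∷ʳ =
        Linked⇒AllPairs (λ {u} → ⋗-trans {u}) (λ♭-descending la (suc k))
      positives : count (map (1 ≤ᵇ_) corners) ≡ k ⊓ kOf la
      positives = begin
        count (map (1 ≤ᵇ_) corners)             ≡⟨ cong count (map-∘ (oneTo k)) ⟨
        count (map ((1 ≤ᵇ_) ∘ λ♭ la) (oneTo k))
          ≡⟨ count-cong-oneTo k (λ { {suc i} _ _ → positive-prefix (flat-⋗ la) i }) ⟩
        count (map (_≤ᵇ kOf la) (oneTo k))       ≡⟨ count-≤ᵇ-oneTo (kOf la) k ⟩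
        k ⊓ kOf la                               ∎

    ircont-Tmax : ircont n la (Tmax n la) ≡ lambdaBar n la
    ircont-Tmax =
      map-cong-local (All-oneTo λ { {suc k} _ k+1≤n → trans (ircontAt-Tmax k+1≤n) (λ̄-entry k) })
      where
      λ̄-entry : ∀ k →
        λ♭ la (suc k) + k ⊓ kOf la ≡ (if suc k ≤ᵇ kOf la then λ♭ la (suc k) + k else kOf la)
      λ̄-entry k with suc k ≤? kOf la
      ... | yes k<κ rewrite dec-true (suc k ≤? kOf la) k<κ =
        cong (λ♭ la (suc k) +_) (m≤n⇒m⊓n≡m (<⇒≤ k<κ))
      ... | no k≮κ rewrite dec-false (suc k ≤? kOf la) k≮κ =
        cong₂ _+_ λ♭-vanishes (m≥n⇒m⊓n≡n (≤-pred (≰⇒> k≮κ)))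
        where
        λ♭-vanishes : λ♭ la (suc k) ≡ 0
        λ♭-vanishes with λ♭ la (suc k) | positive-prefix (flat-⋗ la) k
        ... | zero  | _   = refl
        ... | suc _ | pos = ⊥-elim (k≮κ (≤ᵇ⇒≤ _ _ (subst T pos _)))

lemma4p4 : (la : List ℕ) → IsPartition la → (n : ℕ) → 1 ≤ n →
    HighestWeight n la (Tmax n la) × ircont n la (Tmax n la) ≡ lambdaBar n la
lemma4p4 la (la≥ , _) n 1≤n = highestWeight-Tmax n la la≥ 1≤n , ircont-Tmax n la la≥
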